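{- Let $\vec U$ be a submodular universe, $k\in\mathbb N$, and $\mathcal P$ a set of regular profiles of $S_k$. Let $\mathcal F_e$ be the set of all stars $\sigma\subseteq\vec S_k$ which are contained in at most one profile in $\mathcal P$ and which, if contained in a profile $P\in\mathcal P$, have property $\mathrm{Eff}(P)$. Then $S_k$ is $\mathcal F_e$-separable.
   Context: A separation system is a finite poset $(\vec S,\le)$ with an order-reversing involution ${}^*$; write $\overleftarrow s:=\vec s^{\,*}$, $s:=\{\vec s,\overleftarrow s\}$. $\vec s$ is small if $\vec s\le\overleftarrow s$ (then $\overleftarrow s$ is cosmall), trivial if there is $r\neq s$ with $\vec s\le\vec r$ and $\vec s\le\overleftarrow r$, degenerate if $\vec s=\overleftarrow s$. A universe $\vec U$ is a separation system whose poset is a lattice ($\vee,\wedge$); it is submodular if it carries $|\cdot|:\vec U\to\mathbb N_0$ with $|\vec s|=|\overleftarrow s|=:|s|$ and $|\vec s|+|\vec t|\ge|\vec s\vee\vec t|+|\vec s\wedge\vec t|$. $\vec S_k:=\{\vec s\in\vec U:|\vec s|<k\}$. A profile of $S_k$ is a consistent orientation $P$ (exactly one orientation of each $s\in S_k$, no $\vec a,\vec b$ with $a\neq b$, $\overleftarrow a\le\vec b$) with $\overleftarrow a\wedge\overleftarrow b\notin P$ for all $\vec a,\vec b\in P$; regular if it contains no cosmall separation. A star is a set $\sigma$ with $\vec a\le\overleftarrow b$ for all distinct $\vec a,\vec b\in\sigma$; $\sigma$ has $\mathrm{Eff}(P)$ if there are no $\vec a\in\sigma$, $\vec a'\in P$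 with $\vec a\le\vec a'$ and $|a'|<|a|$. Shift: $\sigma^{\vec s_0}_{\vec x}:=\{\vec x\vee\vec s_0\}\cup\{\vec y\wedge\overleftarrow{s_0}:\vec y\in\sigma\setminus\{\vec x\}\}$ for $\vec x\in\sigma$. For a set $\mathcal F$ of stars and a separation system $\vec S$: $\mathcal F$ forces $\vec r$ if $\{\overleftarrow r\}\in\mathcal F$; $\vec s$ emulates $\vec r$ in $\vec S$ if $\vec s\ge\vec r$ and $\vec s\vee\vec t\in\vec S$ for every $\vec t\in\vec S\setminus\{\overleftarrow r\}$ with $\vec t\ge\vec r$; it does so for $\mathcal F$ if additionally $\sigma^{\vec s}_{\vec x}\in\mathcal F$ for every $\sigma\in\mathcal F$ with $\overleftarrow r\notin\sigma$ and every $\vec x\in\sigma$ with $\vec x\ge\vec r$. $S$ is $\mathcal F$-separable if for any two nontrivial nondegenerate $\vec r_1,\vec r_2\in\vec S$ not forced by $\mathcal F$ with $\vec r_1\le\overleftarrow{r_2}$ there is $\vec s_0\in\vec S$ with $\vec r_1\le\vec s_0\le\overleftarrow{r_2}$ such that $\vec s_0$ emulates $\vec r_1$ in $\vec S$ for $\mathcal F$ and $\overleftarrow{s_0}$ emulates $\vec r_2$ in $\vec S$ for $\mathcal F$. -}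

module Defs where

open import Level using (0ℓ)
open import Data.Nat using (ℕ; _+_; _<_; _≤_)
open import Data.Product using (Σ; ∃; _×_; _,_)
open import Data.Sum using (_⊎_)
open import Data.List using (List)
open import Data.List.Membership.Propositional using (_∈_)
open import Relation.Nullary using (¬_)
open import Relation.Binary.PropositionalEquality using (_≡_; _≢_)
open import Relation.Binary.Definitions using (DecidableEquality)
open import Relation.Binary.Lattice.Structures using (IsLattice)

record SubmodularUniverse : Set₁ where
  infix 4 _≼_
  infixr 6 _∨_
  infixr 7 _∧_
  field
    Carrier    : Set
    _≼_        : Carrier → Carrier → Set
    _∨_        : Carrier → Carrier → Carrier
    _∧_        : Carrier → Carrier → Carrier
    isLattice  : IsLattice _≡_ _≼_ _∨_ _∧_
    -- finiteness (a separation system is a finite poset)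
    enum       : List Carrier
    enum-complete : ∀ x → x ∈ enum
    _≟_        : DecidableEquality Carrier
    _*         : Carrier → Carrier
    *-invol    : ∀ x → (x *) * ≡ x
    *-reverse  : ∀ {x y} → x ≼ y → (y *) ≼ (x *)
    ∣_∣        : Carrier → ℕ
    ∣*∣        : ∀ x → ∣ x * ∣ ≡ ∣ x ∣
    submodular : ∀ x y → ∣ x ∨ y ∣ + ∣ x ∧ y ∣ ≤ ∣ x ∣ + ∣ y ∣

module _ (U : SubmodularUniverse) where
  open SubmodularUniverse U

  SubSet : Set₁
  SubSet = Carrier → Set

  _⊆_ : SubSet → SubSet → Set
  A ⊆ B = ∀ x → A x → B x

  _≐_ : SubSet → SubSet → Set
  A ≐ B = (A ⊆ B) × (B ⊆ A)

  S< : ℕ → SubSet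
  S< k x = ∣ x ∣ < k

  small : Carrier → Set
  small x = x ≼ x *

  cosmall : Carrier → Set
  cosmall x = small (x *)

  degenerate : Carrier → Set
  degenerate x = x ≡ x *

  -- the unoriented separations {r,r*} and {s,s*} differ
  distinctSep : Carrier → Carrier → Set
  distinctSep r s = (r ≢ s) × (r ≢ s *)

  trivialIn : SubSet → Carrier → Set
  trivialIn S s = ∃ λ r → S r × distinctSep r s × (s ≼ r) × (s ≼ r *)

  isOrientation : ℕ → SubSet → Set
  isOrientation k P =
    (P ⊆ S< k) ×
    (∀ x → S< k x → P x ⊎ P (x *)) ×
    (∀ x → P x → P (x *) → x ≡ x *)

  consistent : SubSet → Set
  consistent P = ∀ a b → P a → P b → distinctSep a b → ¬ (a * ≼ b)

  isProfile : ℕ → SubSet → Set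
  isProfile k P =
    isOrientation k P × consistent P ×
    (∀ a b → P a → P b → ¬ P (a * ∧ b *))

  isRegularProfile : ℕ → SubSet → Set
  isRegularProfile k P = isProfile k P × (∀ x → P x → ¬ cosmall x)

  isStar : SubSet → Set
  isStar σ = ∀ a b → σ a → σ b → a ≢ b → a ≼ b *

  Eff : SubSet → SubSet → Set
  Eff P σ = ¬ (∃ λ a → ∃ λ a' → σ a × P a' × (a ≼ a') × (∣ a' ∣ < ∣ a ∣))

  shift : SubSet → Carrier → Carrier → SubSet
  shift σ s x w = (w ≡ x ∨ s) ⊎ (∃ λ y → σ y × y ≢ x × w ≡ y ∧ s *)

  StarSet : Set₂
  StarSet = SubSet → Set₁

  forces : StarSet → Carrier → Set₁
  forces F r = F (λ y → y ≡ r *)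

  emulates : SubSet → Carrier → Carrier → Set
  emulates S r s = (r ≼ s) × (∀ t → S t → t ≢ r * → r ≼ t → S (s ∨ t))

  emulatesFor : SubSet → StarSet → Carrier → Carrier → Set₁
  emulatesFor S F r s =
    emulates S r s ×
    (∀ σ → F σ → ¬ σ (r *) → ∀ x → σ x → r ≼ x → F (shift σ s x))

  separable : SubSet → StarSet → Set₁
  separable S F =
    ∀ r₁ r₂ → S r₁ → S r₂ →
    ¬ trivialIn S r₁ → ¬ degenerate r₁ → ¬ forces F r₁ →
    ¬ trivialIn S r₂ → ¬ degenerate r₂ → ¬ forces F r₂ →
    r₁ ≼ r₂ * →
    ∃ λ s₀ → S s₀ × (r₁ ≼ s₀) × (s₀ ≼ r₂ *) ×
      emulatesFor S F r₁ s₀ × emulatesFor S F r₂ (s₀ *)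

  Fe : ℕ → (SubSet → Set₁) → StarSet
  Fe k 𝒫 σ =
    (σ ⊆ S< k) × isStar σ ×
    (∀ P Q → 𝒫 P → 𝒫 Q → σ ⊆ P → σ ⊆ Q → P ≐ Q) ×
    (∀ P → 𝒫 P → σ ⊆ P → Eff P σ)

-- Given r₁ ≤ r₂*, take s₀ of minimal order among the separations between r₁ and r₂*.
-- Submodularity turns minimality into the two corner inequalities |t ∨ s₀| ≤ |t| for
-- r₁ ≤ t and |w ∧ s₀*| ≤ |w| for r₁ ≤ w*, so joining with s₀ (and meeting with s₀*)
-- never raises the order: this keeps S_k closed under the moves in "emulation", and
-- it makes the shift of an Eff(P)-star again Eff(P), since a witness against
-- efficiency of the shifted star pulls back to one against the original star.
-- A regular profile containing the shifted star contains the original star, so the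
-- shift is still contained in at most one profile of 𝒫. By symmetry s₀* is minimal
-- between r₂ and r₁*, and serves for r₂.
module Submission where

open import Defs
open import Data.Nat using (ℕ; _+_; _<_; _≤_)
open import Data.Nat.Properties
  using (≤-totalOrder; ≤-<-trans; <-≤-trans; <-trans;
         +-cancelʳ-≤; +-cancelʳ-<; +-monoʳ-≤; +-monoʳ-<; module ≤-Reasoning)
open import Data.Product using (∃; _×_; _,_; proj₁; proj₂)
open import Data.Sum using (_⊎_; inj₁; inj₂)
open import Data.Empty using (⊥-elim)
open import Data.List using (List; filter)
open import Data.List.Relation.Unary.All using (lookup)
open import Data.List.Relation.Unary.All.Properties using (all-filter)
open import Data.List.Membership.Propositional.Properties using (∈-filter⁺)
open import Data.List.Extrema ≤-totalOrder using (argmin; argmin-all; f[argmin]≤f[xs])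
open import Relation.Nullary using (¬_; Dec; yes; no)
open import Relation.Nullary.Decidable using (_×-dec_)
open import Relation.Unary using (Decidable)
open import Relation.Binary.PropositionalEquality
  using (_≡_; _≢_; refl; sym; cong; subst; subst₂; module ≡-Reasoning)
open import Relation.Binary.Lattice.Bundles using (Lattice)
open import Relation.Binary.Lattice.Structures using (IsLattice)
import Relation.Binary.Lattice.Properties.JoinSemilattice as JoinSemilatticeProperties

module Separation (U : SubmodularUniverse) where
  open SubmodularUniverse U
  open IsLattice isLattice
    using (x≤x∨y; y≤x∨y; ∨-least; x∧y≤x; x∧y≤y; ∧-greatest; antisym)
    renaming (refl to ≼-refl; trans to ≼-trans)

  lattice : Lattice _ _ _
  lattice = record { isLattice = isLattice }

  open JoinSemilatticeProperties (Lattice.joinSemilattice lattice)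
    using (∨-comm) renaming (≈-dec⇒≤-dec to ≡-dec⇒≼-dec)

  _≼?_ : ∀ x y → Dec (x ≼ y)
  _≼?_ = ≡-dec⇒≼-dec _≟_

  *-injective : ∀ {a b} → a * ≡ b * → a ≡ b
  *-injective {a} {b} a*≡b* = begin
    a       ≡⟨ sym (*-invol a) ⟩
    a * *   ≡⟨ cong _* a*≡b* ⟩
    b * *   ≡⟨ *-invol b ⟩
    b       ∎
    where open ≡-Reasoning

  *-swapʳ : ∀ {a b} → a ≼ b * → b ≼ a *
  *-swapʳ {a} {b} a≼b* = subst (_≼ a *) (*-invol b) (*-reverse a≼b*)

  *-distrib-∨ : ∀ a b → (a ∨ b) * ≡ a * ∧ b *
  *-distrib-∨ a b = antisym
    (∧-greatest (*-reverse (x≤x∨y a b)) (*-reverse (y≤x∨y a b)))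
    (*-swapʳ (∨-least (*-swapʳ (x∧y≤x (a *) (b *))) (*-swapʳ (x∧y≤y (a *) (b *)))))

  star-≼* : ∀ {σ x y} → isStar U σ → σ x → σ y → y ≢ x → x ≼ y *
  star-≼* star σx σy y≢x = *-swapʳ (star _ _ σy σx y≢x)

  ∣∨∣≤ˡ : ∀ {x y} → ∣ y ∣ ≤ ∣ x ∧ y ∣ → ∣ x ∨ y ∣ ≤ ∣ x ∣
  ∣∨∣≤ˡ {x} {y} ∣y∣≤ = +-cancelʳ-≤ (∣ x ∧ y ∣) (∣ x ∨ y ∣) (∣ x ∣) (begin
    ∣ x ∨ y ∣ + ∣ x ∧ y ∣  ≤⟨ submodular x y ⟩
    ∣ x ∣ + ∣ y ∣          ≤⟨ +-monoʳ-≤ (∣ x ∣) ∣y∣≤ ⟩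
    ∣ x ∣ + ∣ x ∧ y ∣      ∎)
    where open ≤-Reasoning

  ∣∨∣<ˡ : ∀ {x y} → ∣ y ∣ < ∣ x ∧ y ∣ → ∣ x ∨ y ∣ < ∣ x ∣
  ∣∨∣<ˡ {x} {y} ∣y∣< = +-cancelʳ-< (∣ x ∧ y ∣) (∣ x ∨ y ∣) (∣ x ∣) (begin-strict
    ∣ x ∨ y ∣ + ∣ x ∧ y ∣  ≤⟨ submodular x y ⟩
    ∣ x ∣ + ∣ y ∣          <⟨ +-monoʳ-< (∣ x ∣) ∣y∣< ⟩
    ∣ x ∣ + ∣ x ∧ y ∣      ∎)
    where open ≤-Reasoning

  module RegularProfile {k : ℕ} {P : SubSet U} (reg : isRegularProfile U k P) where

    oriented : ∀ x → ∣ x ∣ < k → P x ⊎ P (x *)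
    oriented = proj₁ (proj₂ (proj₁ (proj₁ reg)))

    consistent-P : consistent U P
    consistent-P = proj₁ (proj₂ (proj₁ reg))

    co-meet-∉ : ∀ a b → P a → P b → ¬ P (a * ∧ b *)
    co-meet-∉ = proj₂ (proj₂ (proj₁ reg))

    regular : ∀ x → P x → ¬ cosmall U x
    regular = proj₂ reg

    ↓-closed : ∀ {a b} → P a → b ≼ a → ∣ b ∣ < k → P b
    ↓-closed {a} {b} Pa b≼a ∣b∣<k with b ≟ a
    ... | yes refl = Pa
    ... | no b≢a with oriented b ∣b∣<k
    ...   | inj₁ Pb = Pb
    ...   | inj₂ Pb* with (b *) ≟ a
    ...     | yes refl = ⊥-elim (regular (b *) Pb*
                           (subst₂ _≼_ (sym (*-invol b)) (sym (*-invol (b *))) b≼a))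
    ...     | no b*≢a = ⊥-elim (consistent-P (b *) a Pb* Pa
                           (b*≢a , λ b*≡a* → b≢a (*-injective b*≡a*))
                           (subst (_≼ a) (sym (*-invol b)) b≼a))

    ∨-closed : ∀ {a b} → P a → P b → ∣ a ∨ b ∣ < k → P (a ∨ b)
    ∨-closed {a} {b} Pa Pb ∣a∨b∣<k with oriented (a ∨ b) ∣a∨b∣<k
    ... | inj₁ Pa∨b = Pa∨b
    ... | inj₂ P[a∨b]* = ⊥-elim (co-meet-∉ a b Pa Pb (subst P (*-distrib-∨ a b) P[a∨b]*))

    shift-⊆⇒⊆ : ∀ {σ s x} → _⊆_ U σ (S< U k) → ∣ s ∣ < k → σ x →
                _⊆_ U (shift U σ s x) P → _⊆_ U σ P
    shift-⊆⇒⊆ {σ} {s} {x} σ⊆S ∣s∣<k σx shift⊆P y σy with y ≟ x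
    ... | yes refl = ↓-closed (shift⊆P _ (inj₁ refl)) (x≤x∨y x s) (σ⊆S x σx)
    ... | no y≢x with oriented y (σ⊆S y σy)
    ...   | inj₁ Py = Py
    ...   | inj₂ Py* = ⊥-elim (co-meet-∉ (y *) s Py*
                         (↓-closed (shift⊆P _ (inj₁ refl)) (y≤x∨y x s) ∣s∣<k)
                         (subst (λ z → P (z ∧ s *)) (sym (*-invol y))
                           (shift⊆P _ (inj₂ (y , σy , y≢x , refl)))))

  shift-isStar : ∀ {σ s x} → isStar U σ → σ x → isStar U (shift U σ s x)
  shift-isStar {σ} {s} {x} star σx = star′
    where
      mate≼head* : ∀ {y} → σ y → y ≢ x → y ∧ s * ≼ (x ∨ s) *
      mate≼head* {y} σy y≢x = subst (y ∧ s * ≼_) (sym (*-distrib-∨ x s))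
        (∧-greatest (≼-trans (x∧y≤x _ _) (star _ x σy σx y≢x)) (x∧y≤y _ _))

      star′ : isStar U (shift U σ s x)
      star′ _ _ (inj₁ refl) (inj₁ refl) ne = ⊥-elim (ne refl)
      star′ _ _ (inj₁ refl) (inj₂ (y , σy , y≢x , refl)) _ = *-swapʳ (mate≼head* σy y≢x)
      star′ _ _ (inj₂ (y , σy , y≢x , refl)) (inj₁ refl) _ = mate≼head* σy y≢x
      star′ _ _ (inj₂ (y , σy , _ , refl)) (inj₂ (z , σz , _ , refl)) ne =
        ≼-trans (x∧y≤x y _)
          (≼-trans (star y z σy σz (λ { refl → ne refl })) (*-reverse (x∧y≤x z _)))

  record IsMinimalBetween (r u s : Carrier) : Set where
    field
      lower   : r ≼ s
      upper   : s ≼ u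
      minimal : ∀ {t} → r ≼ t → t ≼ u → ∣ s ∣ ≤ ∣ t ∣

  minimalBetween-exists : ∀ {r u} → r ≼ u → ∃ (IsMinimalBetween r u)
  minimalBetween-exists {r} {u} r≼u = s , record
    { lower = proj₁ between-s ; upper = proj₂ between-s ; minimal = minimal }
    where
      Between : Carrier → Set
      Between t = r ≼ t × t ≼ u

      between? : Decidable Between
      between? t = (r ≼? t) ×-dec (t ≼? u)

      candidates : List Carrier
      candidates = filter between? enum

      s : Carrier
      s = argmin ∣_∣ r candidates

      between-s : Between s
      between-s = argmin-all ∣_∣ (≼-refl , r≼u) (all-filter between? enum)

      minimal : ∀ {t} → r ≼ t → t ≼ u → ∣ s ∣ ≤ ∣ t ∣
      minimal {t} r≼t t≼u = lookup (f[argmin]≤f[xs] r candidates)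
        (∈-filter⁺ between? (enum-complete t) (r≼t , t≼u))

  minimalBetween-* : ∀ {r v s} → IsMinimalBetween r (v *) s → IsMinimalBetween v (r *) (s *)
  minimalBetween-* {r} {v} {s} m = record
    { lower   = *-swapʳ upper
    ; upper   = *-reverse lower
    ; minimal = λ {t} v≼t t≼r* → subst₂ _≤_ (sym (∣*∣ s)) (∣*∣ t)
                  (minimal (*-swapʳ t≼r*) (*-reverse v≼t))
    }
    where open IsMinimalBetween m

  module Minimal {r u s} (m : IsMinimalBetween r u s) where
    open IsMinimalBetween m

    ∣s∣≤∣r∣ : ∣ s ∣ ≤ ∣ r ∣
    ∣s∣≤∣r∣ = minimal ≼-refl (≼-trans lower upper)

    ∣t∨s∣≤∣t∣ : ∀ {t} → r ≼ t → ∣ t ∨ s ∣ ≤ ∣ t ∣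
    ∣t∨s∣≤∣t∣ {t} r≼t = ∣∨∣≤ˡ (minimal (∧-greatest r≼t lower) (≼-trans (x∧y≤y t s) upper))

    ∣w∧s*∣≤∣w∣ : ∀ {w} → r ≼ w * → ∣ w ∧ s * ∣ ≤ ∣ w ∣
    ∣w∧s*∣≤∣w∣ {w} r≼w* = begin
      ∣ w ∧ s * ∣       ≡⟨ cong (λ z → ∣ z ∧ s * ∣) (sym (*-invol w)) ⟩
      ∣ w * * ∧ s * ∣   ≡⟨ cong ∣_∣ (sym (*-distrib-∨ (w *) s)) ⟩
      ∣ (w * ∨ s) * ∣   ≡⟨ ∣*∣ (w * ∨ s) ⟩
      ∣ w * ∨ s ∣       ≤⟨ ∣t∨s∣≤∣t∣ r≼w* ⟩
      ∣ w * ∣           ≡⟨ ∣*∣ w ⟩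
      ∣ w ∣             ∎
      where open ≤-Reasoning

    ∣y∧s*∣≤∣y∧a∣ : ∀ {y a} → r ≼ y * → y ∧ s * ≼ a → ∣ y ∧ s * ∣ ≤ ∣ y ∧ a ∣
    ∣y∧s*∣≤∣y∧a∣ {y} {a} r≼y* y∧s*≼a =
      subst (λ z → ∣ z ∣ ≤ ∣ y ∧ a ∣) y∧a∧s*≡y∧s*
        (∣w∧s*∣≤∣w∣ (≼-trans r≼y* (*-reverse (x∧y≤x y a))))
      where
        y∧a∧s*≡y∧s* : (y ∧ a) ∧ s * ≡ y ∧ s *
        y∧a∧s*≡y∧s* = antisym
          (∧-greatest (≼-trans (x∧y≤x _ _) (x∧y≤x y a)) (x∧y≤y _ _))
          (∧-greatest (∧-greatest (x∧y≤x y _) y∧s*≼a) (x∧y≤y y _))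

    emulates-minimal : ∀ {k} → emulates U (S< U k) r s
    emulates-minimal = lower , λ t ∣t∣<k _ r≼t →
      subst (λ z → ∣ z ∣ < _) (∨-comm t s) (≤-<-trans (∣t∨s∣≤∣t∣ r≼t) ∣t∣<k)

    module _ {k : ℕ} {σ : SubSet U} {x : Carrier} (σ⊆S : _⊆_ U σ (S< U k))
             (star : isStar U σ) (σx : σ x) (r≼x : r ≼ x) where

      r≼mate* : ∀ {y} → σ y → y ≢ x → r ≼ y *
      r≼mate* σy y≢x = ≼-trans r≼x (star-≼* star σx σy y≢x)

      shift-⊆-S< : _⊆_ U (shift U σ s x) (S< U k)
      shift-⊆-S< _ (inj₁ refl) = ≤-<-trans (∣t∨s∣≤∣t∣ r≼x) (σ⊆S x σx)
      shift-⊆-S< _ (inj₂ (y , σy , y≢x , refl)) =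
        ≤-<-trans (∣w∧s*∣≤∣w∣ (r≼mate* σy y≢x)) (σ⊆S y σy)

      shift-Eff : ∀ {P} → isRegularProfile U k P → _⊆_ U σ P →
                  Eff U P σ → Eff U P (shift U σ s x)
      shift-Eff _ _ eff (_ , a , inj₁ refl , Pa , x∨s≼a , ∣a∣<) =
        eff (x , a , σx , Pa , ≼-trans (x≤x∨y x s) x∨s≼a , <-≤-trans ∣a∣< (∣t∨s∣≤∣t∣ r≼x))
      shift-Eff {P} reg σ⊆P eff (_ , a , inj₂ (y , σy , y≢x , refl) , Pa , y∧s*≼a , ∣a∣<) =
        eff (y , y ∨ a , σy , P[y∨a] , x≤x∨y y a , ∣y∨a∣<∣y∣)
        where
          ∣y∨a∣<∣y∣ : ∣ y ∨ a ∣ < ∣ y ∣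
          ∣y∨a∣<∣y∣ = ∣∨∣<ˡ (<-≤-trans ∣a∣< (∣y∧s*∣≤∣y∧a∣ (r≼mate* σy y≢x) y∧s*≼a))

          P[y∨a] : P (y ∨ a)
          P[y∨a] = RegularProfile.∨-closed reg (σ⊆P y σy) Pa (<-trans ∣y∨a∣<∣y∣ (σ⊆S y σy))

  module _ (k : ℕ) (𝒫 : SubSet U → Set₁) (reg : ∀ P → 𝒫 P → isRegularProfile U k P)
           {r u s} (m : IsMinimalBetween r u s) (∣r∣<k : ∣ r ∣ < k) where
    open Minimal m

    shift-∈-Fe : ∀ {σ x} → Fe U k 𝒫 σ → σ x → r ≼ x → Fe U k 𝒫 (shift U σ s x)
    shift-∈-Fe {σ} {x} (σ⊆S , star , unique , eff) σx r≼x =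
        shift-⊆-S< σ⊆S star σx r≼x
      , shift-isStar star σx
      , (λ P Q 𝒫P 𝒫Q shift⊆P shift⊆Q →
           unique P Q 𝒫P 𝒫Q (unshift P 𝒫P shift⊆P) (unshift Q 𝒫Q shift⊆Q))
      , λ P 𝒫P shift⊆P → let σ⊆P = unshift P 𝒫P shift⊆P in
           shift-Eff σ⊆S star σx r≼x (reg P 𝒫P) σ⊆P (eff P 𝒫P σ⊆P)
      where
        unshift : ∀ P → 𝒫 P → _⊆_ U (shift U σ s x) P → _⊆_ U σ P
        unshift P 𝒫P = RegularProfile.shift-⊆⇒⊆ (reg P 𝒫P) σ⊆S (≤-<-trans ∣s∣≤∣r∣ ∣r∣<k) σx

    emulatesFor-minimal : emulatesFor U (S< U k) (Fe U k 𝒫) r s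
    emulatesFor-minimal = emulates-minimal , λ _ Fσ _ _ σx r≼x → shift-∈-Fe Fσ σx r≼x

open Separation

mainTheorem7 : (U : SubmodularUniverse) (k : ℕ) (𝒫 : SubSet U → Set₁) →
    (∀ P → 𝒫 P → isRegularProfile U k P) →
    separable U (S< U k) (Fe U k 𝒫)
mainTheorem7 U k 𝒫 reg r₁ r₂ ∣r₁∣<k ∣r₂∣<k _ _ _ _ _ _ r₁≼r₂* =
  let s₀ , m = minimalBetween-exists U r₁≼r₂*
      open IsMinimalBetween m
  in  s₀
    , ≤-<-trans (Minimal.∣s∣≤∣r∣ U m) ∣r₁∣<k
    , lower
    , upper
    , emulatesFor-minimal U k 𝒫 reg m ∣r₁∣<k
    , emulatesFor-minimal U k 𝒫 reg (minimalBetween-* U m) ∣r₂∣<k
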